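{- Let $n\ge1$ and let $b,m$ be nonnegative integers. Then, as formal series, \[ \prod_{i=1}^n(1-x_i)^{ -b}\prod_{1\le i<j\le n}(x_j-x_i)^{ -m}=\sum_{\substack{A^{(1)},\dots,A^{(m)}\in\mathcal U_{n\times n}\\ B\in\mathcal M_{n\times b}}}\ \prod_{i=1}^n x_i^{\sum_{j=1}^m h_i(A^{(j)})+r_i(B)}. \] In particular, when $m=1$, \[ \prod_{i=1}^n(1-x_i)^{ -b}\prod_{1\le i<j\le n}(x_j-x_i)^{ -1}=\sum_{A\in\mathcal U_{n\times(n+b)}}x_1^{h_1(A)}\cdots x_n^{h_n(A)}. \]
   Context: $\mathcal M_{n\times m}$ denotes the set of $n\times m$ matrices with nonnegative integer entries. $\mathcal U_{n\times m}$ denotes the set of $A\in\mathcal M_{n\times m}$ that are upper triangular ($A_{i,j}=0$ whenever $i>j$) and have diagonal entries $A_{i,i}=i-1$ for $i=1,\dots,\min(n,m)$. For $A\in\mathcal M_{n\times m}$ and $k\ge1$, the $k$th row sum is $r_k(A)=\sum_{i=1}^m A_{k,i}$ and the $k$th hook sum is $h_k(A)=\sum_{i=k+1}^m A_{k,i}-\sum_{j=1}^k A_{j,k}$. Here $(1-x_i)^{ -b}$ is expanded as a power series in $x_i$, and for $i<j$, $1/(x_j-x_i)$ is interpreted as the Laurent series $x_j^{ -1}\sum_{k\ge0}x_i^kx_j^{ -k}$. -}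

module Defs where

open import Data.Nat using (ℕ; zero; suc; _+_; _<_; _≤_; _<ᵇ_; _≤ᵇ_)
open import Data.Integer using (ℤ; +_; _-_) renaming (_+_ to _+ℤ_)
open import Data.Fin using (Fin; toℕ; _↑ˡ_) renaming (zero to fzero; suc to fsuc)
open import Data.Vec using (Vec; lookup)
open import Data.List using (List; length)
open import Data.List.Relation.Unary.Unique.Propositional using (Unique)
open import Data.List.Membership.Propositional using (_∈_)
open import Data.Product using (Σ; _×_; _,_)
open import Data.Bool using (if_then_else_)
open import Function.Bundles using (_⇔_)
open import Relation.Binary.PropositionalEquality using (_≡_)

-- n × m matrices with nonnegative integer entries (the set M_{n×m}),
-- stored as n rows of length m.  Indices are 0-based: entry A i j is A_{i+1,j+1}.
Mat : ℕ → ℕ → Set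
Mat n m = Vec (Vec ℕ m) n

entry : ∀ {n m} → Mat n m → Fin n → Fin m → ℕ
entry A i j = lookup (lookup A i) j

∑ : ∀ {k} → (Fin k → ℕ) → ℕ
∑ {zero}  f = 0
∑ {suc k} f = f fzero + ∑ (λ i → f (fsuc i))

∑ℤ : ∀ {k} → (Fin k → ℤ) → ℤ
∑ℤ {zero}  f = + 0
∑ℤ {suc k} f = f fzero +ℤ ∑ℤ (λ i → f (fsuc i))

rowSum : ∀ {n m} → Mat n m → Fin n → ℕ
rowSum A k = ∑ (λ i → entry A k i)

-- k-th hook sum h_k(A) = Σ_{i=k+1}^{m} A_{k,i} − Σ_{j=1}^{k} A_{j,k},
-- for an n × (n + c) matrix (so column k exists for every row k).
hookSum : ∀ {n c} → Mat n (n + c) → Fin n → ℤ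
hookSum {n} {c} A k =
  (+ ∑ (λ i → if toℕ k <ᵇ toℕ i then entry A k i else 0))
  - (+ ∑ (λ j → if toℕ j ≤ᵇ toℕ k then entry A j (k ↑ˡ c) else 0))

-- membership in U_{n×(n+c)}: upper triangular, and A_{i,i} = i − 1 (1-based),
-- i.e. entry A i i = toℕ i (0-based); here min(n, n+c) = n.
IsU : ∀ {n c} → Mat n (n + c) → Set
IsU {n} {c} A =
  (∀ (i : Fin n) (j : Fin (n + c)) → toℕ j < toℕ i → entry A i j ≡ 0)
  × (∀ (i : Fin n) → entry A i (i ↑ˡ c) ≡ toℕ i)

HasCount : {X : Set} → (X → Set) → ℕ → Set
HasCount {X} P N =
  Σ (List X) λ L → Unique L × (∀ x → P x ⇔ (x ∈ L)) × length L ≡ N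

-- Left-hand side, expanded as a product of formal series.
-- (1−x_i)^{-b} = ((1−x_i)^{-1})^b with (1−x_i)^{-1} = Σ_{t≥0} x_i^t, and
-- (x_j−x_i)^{-m} = ((x_j−x_i)^{-1})^m with (x_j−x_i)^{-1} = Σ_{k≥0} x_i^k x_j^{-k-1}.
-- A term of the expanded product is a choice of
--   C i t  (i ∈ [n], t ∈ [b])       : exponent picked in the t-th factor (1−x_i)^{-1},
--   K l i j (l ∈ [m], i < j)        : summation index k picked in the l-th factor (x_j−x_i)^{-1};
-- entries K l i j with i ≥ j are unused and required to be 0.
-- The coefficient of x^e on the left is the number of such choices with monomial x^e.

LHSIndex : ℕ → ℕ → ℕ → Set
LHSIndex n b m = Mat n b × Vec (Mat n n) m

lhsExp : ∀ {n b m} → LHSIndex n b m → Fin n → ℤ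
lhsExp (C , K) i =
  (+ ∑ (λ t → entry C i t))
  +ℤ ∑ℤ (λ l →
        (+ ∑ (λ j → if toℕ i <ᵇ toℕ j then entry (lookup K l) i j else 0))
        - (+ ∑ (λ j → if toℕ j <ᵇ toℕ i then suc (entry (lookup K l) j i) else 0)))

LHSTerm : (n b m : ℕ) → (Fin n → ℤ) → LHSIndex n b m → Set
LHSTerm n b m e (C , K) =
  (∀ (l : Fin m) (i j : Fin n) → toℕ j ≤ toℕ i → entry (lookup K l) i j ≡ 0)
  × (∀ (i : Fin n) → lhsExp {n} {b} {m} (C , K) i ≡ e i)

RHSIndex : ℕ → ℕ → ℕ → Set
RHSIndex n b m = Vec (Mat n (n + 0)) m × Mat n b

RHSTerm : (n b m : ℕ) → (Fin n → ℤ) → RHSIndex n b m → Set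
RHSTerm n b m e (As , B) =
  (∀ (l : Fin m) → IsU {n} {0} (lookup As l))
  × (∀ (i : Fin n) → ∑ℤ (λ l → hookSum {n} {0} (lookup As l) i) +ℤ (+ rowSum B i) ≡ e i)

RHS1Term : (n b : ℕ) → (Fin n → ℤ) → Mat n (n + b) → Set
RHS1Term n b e A = IsU {n} {b} A × (∀ (i : Fin n) → hookSum {n} {b} A i ≡ e i)

-- A term of the expanded left-hand side is a choice of exponents C for the factors (1 − x_i)^{-1}
-- together with, for each of the m copies of ∏_{i<j} (x_j − x_i)^{-1}, a strictly upper triangular
-- matrix K of summation indices.  Adding diag(0, 1, …, n − 1) to K gives a matrix of U whose hook
-- sums are the exponents contributed by K: the arm of row i collects the indices k of the factors
-- (x_j − x_i)^{-1}, the leg of column i the −(k + 1) of the factors (x_i − x_j)^{-1}, its diagonal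
-- entry i − 1 supplying the i − 1 summands −1.  Appending C as extra columns gives the case m = 1.
-- Hence for each monomial x^e the terms of both sides are in bijection.  There are finitely many,
-- since the exponent of x_i bounds row i by the entries above it in column i, and hence, by
-- induction on i, bounds every entry.
module Submission where

open import Defs
open import Data.Nat using (ℕ; zero; suc; _+_; _*_; _<_; _≤_; _<ᵇ_; _≤ᵇ_; _≡ᵇ_; z≤n; s≤s; _<?_; _≤?_)
  renaming (_≟_ to _≟ℕ_)
open import Data.Nat.Properties
  using (≤-refl; ≤-reflexive; ≤-trans; <⇒≤; ≮⇒≥; ≰⇒>; <-irrefl; <-cmp)
  using (+-comm; +-assoc; +-identityʳ; +-mono-≤)
  using (m≤m+n; m≤n+m; m≤n+m∸n)
open import Data.Integer using (ℤ; +_; -_; _-_; ∣_∣) renaming (_+_ to _+ℤ_; _≟_ to _≟ℤ_)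
open import Data.Integer.Properties using (pos-+; [+m]-[+n]≡m⊖n; ⊖-≥)
  renaming (+-comm to +ℤ-comm; +-assoc to +ℤ-assoc)
import Data.Nat.Tactic.RingSolver as ℕ-Solver
import Data.Integer.Tactic.RingSolver as ℤ-Solver
open import Data.Fin using (Fin; toℕ; _↑ˡ_; _↑ʳ_; splitAt) renaming (zero to fzero; suc to fsuc)
open import Data.Fin.Properties
  using (toℕ-↑ˡ; toℕ-↑ʳ; toℕ<n; toℕ-injective; all?)
  using (splitAt-↑ˡ; splitAt-↑ʳ; splitAt⁻¹-↑ˡ; splitAt⁻¹-↑ʳ)
open import Data.Vec using (Vec; []; _∷_; lookup; tabulate; replicate) renaming (map to vmap)
open import Data.Vec.Properties using (lookup∘tabulate; tabulate∘lookup; tabulate-cong; lookup-map)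
  renaming (≡-dec to Vec-≡-dec)
open import Data.List
  using (List; []; _∷_; map; length; upTo; filter; deduplicate; cartesianProductWith; cartesianProduct)
open import Data.List.Properties using (length-map)
open import Data.List.Relation.Unary.All using (All; []; _∷_) renaming (tabulate to All-tabulate)
open import Data.List.Relation.Unary.AllPairs using ([]; _∷_)
open import Data.List.Relation.Unary.Unique.Propositional using (Unique)
open import Data.List.Relation.Unary.Unique.DecPropositional.Properties using (deduplicate-!)
open import Data.List.Relation.Unary.Any using (here)
open import Data.List.Membership.Propositional using (_∈_)
open import Data.List.Membership.Propositional.Properties
  using (∈-map⁺; ∈-map⁻; ∈-filter⁺; ∈-filter⁻; ∈-deduplicate⁺; ∈-deduplicate⁻; ∈-upTo⁺)
  using (∈-cartesianProductWith⁺; ∈-cartesianProduct⁺)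
open import Data.Bool using (true; false; if_then_else_)
open import Data.Sum using (_⊎_; inj₁; inj₂)
open import Data.Product using (Σ; _×_; _,_; proj₁; proj₂)
open import Data.Product.Properties using () renaming (≡-dec to ×-≡-dec)
open import Data.Empty using (⊥-elim)
open import Function using (_∘_)
open import Function.Bundles using (_⇔_; mk⇔; Equivalence)
open import Relation.Nullary using (yes; no; ¬_)
open import Relation.Nullary.Decidable using (_×-dec_; _→-dec_)
open import Relation.Unary using (Decidable)
open import Relation.Binary.Definitions using (DecidableEquality; tri<; tri≈; tri>)
open import Relation.Binary.PropositionalEquality

<⇒<ᵇ≡true : ∀ {a b} → a < b → (a <ᵇ b) ≡ true
<⇒<ᵇ≡true {zero}  {suc b} _         = refl
<⇒<ᵇ≡true {suc a} {suc b} (s≤s a<b) = <⇒<ᵇ≡true a<b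

≥⇒<ᵇ≡false : ∀ {a b} → b ≤ a → (a <ᵇ b) ≡ false
≥⇒<ᵇ≡false {a}     {zero}  _         = refl
≥⇒<ᵇ≡false {suc a} {suc b} (s≤s b≤a) = ≥⇒<ᵇ≡false b≤a

≤⇒≤ᵇ≡true : ∀ {a b} → a ≤ b → (a ≤ᵇ b) ≡ true
≤⇒≤ᵇ≡true {zero}  _   = refl
≤⇒≤ᵇ≡true {suc a} a<b = <⇒<ᵇ≡true a<b

>⇒≤ᵇ≡false : ∀ {a b} → b < a → (a ≤ᵇ b) ≡ false
>⇒≤ᵇ≡false {suc a} (s≤s b≤a) = ≥⇒<ᵇ≡false b≤a

≡ᵇ-refl : ∀ a → (a ≡ᵇ a) ≡ true
≡ᵇ-refl zero    = refl
≡ᵇ-refl (suc a) = ≡ᵇ-refl a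

≢⇒≡ᵇ≡false : ∀ {a b} → ¬ a ≡ b → (a ≡ᵇ b) ≡ false
≢⇒≡ᵇ≡false {zero}  {zero}  a≢b = ⊥-elim (a≢b refl)
≢⇒≡ᵇ≡false {zero}  {suc b} _   = refl
≢⇒≡ᵇ≡false {suc a} {zero}  _   = refl
≢⇒≡ᵇ≡false {suc a} {suc b} a≢b = ≢⇒≡ᵇ≡false (a≢b ∘ cong suc)

∑-cong : ∀ {k} {f g : Fin k → ℕ} → (∀ i → f i ≡ g i) → ∑ f ≡ ∑ g
∑-cong {zero}  f≗g = refl
∑-cong {suc k} f≗g = cong₂ _+_ (f≗g fzero) (∑-cong (f≗g ∘ fsuc))

∑-distrib-+ : ∀ {k} (f g : Fin k → ℕ) → ∑ (λ i → f i + g i) ≡ ∑ f + ∑ g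
∑-distrib-+ {zero}  f g = refl
∑-distrib-+ {suc k} f g = begin
  (f fzero + g fzero) + ∑ (λ i → f (fsuc i) + g (fsuc i))
    ≡⟨ cong (_+_ (f fzero + g fzero)) (∑-distrib-+ (f ∘ fsuc) (g ∘ fsuc)) ⟩
  (f fzero + g fzero) + (∑ (f ∘ fsuc) + ∑ (g ∘ fsuc))
    ≡⟨ interchange (f fzero) (g fzero) (∑ (f ∘ fsuc)) (∑ (g ∘ fsuc)) ⟩
  (f fzero + ∑ (f ∘ fsuc)) + (g fzero + ∑ (g ∘ fsuc)) ∎
  where
  open ≡-Reasoning
  interchange : ∀ a b c d → (a + b) + (c + d) ≡ (a + c) + (b + d)
  interchange = ℕ-Solver.solve-∀

∑-zero : ∀ {k} → ∑ {k} (λ _ → 0) ≡ 0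
∑-zero {zero}  = refl
∑-zero {suc k} = ∑-zero {k}

∑-const : ∀ {k} c → ∑ {k} (λ _ → c) ≡ k * c
∑-const {zero}  c = refl
∑-const {suc k} c = cong (_+_ c) (∑-const {k} c)

∑-mono-≤ : ∀ {k} {f g : Fin k → ℕ} → (∀ i → f i ≤ g i) → ∑ f ≤ ∑ g
∑-mono-≤ {zero}  f≤g = z≤n
∑-mono-≤ {suc k} f≤g = +-mono-≤ (f≤g fzero) (∑-mono-≤ (f≤g ∘ fsuc))

term≤∑ : ∀ {k} (f : Fin k → ℕ) i → f i ≤ ∑ f
term≤∑ f fzero    = m≤m+n _ _
term≤∑ f (fsuc i) = ≤-trans (term≤∑ (f ∘ fsuc) i) (m≤n+m _ _)

∑-↑ : ∀ {n c} (f : Fin (n + c) → ℕ) → ∑ f ≡ ∑ (λ j → f (j ↑ˡ c)) + ∑ (λ t → f (n ↑ʳ t))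
∑-↑ {zero}      f = refl
∑-↑ {suc n} {c} f = trans (cong (_+_ (f fzero)) (∑-↑ {n} {c} (f ∘ fsuc))) (sym (+-assoc (f fzero) _ _))

∑-[<]≡toℕ : ∀ {n} (k : Fin n) → ∑ (λ (j : Fin n) → if toℕ j <ᵇ toℕ k then 1 else 0) ≡ toℕ k
∑-[<]≡toℕ {suc n} fzero    = ∑-zero {n}
∑-[<]≡toℕ {suc n} (fsuc k) = cong suc (∑-[<]≡toℕ k)

∑-[≡] : ∀ {n} (k : Fin n) x → ∑ (λ (j : Fin n) → if toℕ j ≡ᵇ toℕ k then x else 0) ≡ x
∑-[≡] {suc n} fzero    x = trans (cong (_+_ x) (∑-zero {n})) (+-identityʳ x)
∑-[≡] {suc n} (fsuc k) x = ∑-[≡] k x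

∑ℤ-cong : ∀ {k} {f g : Fin k → ℤ} → (∀ i → f i ≡ g i) → ∑ℤ f ≡ ∑ℤ g
∑ℤ-cong {zero}  f≗g = refl
∑ℤ-cong {suc k} f≗g = cong₂ _+ℤ_ (f≗g fzero) (∑ℤ-cong (f≗g ∘ fsuc))

∑ℤ-difference : ∀ {k} (f g : Fin k → ℕ) → ∑ℤ (λ l → + f l - + g l) ≡ + ∑ f - + ∑ g
∑ℤ-difference {zero}  f g = refl
∑ℤ-difference {suc k} f g = begin
  (+ f fzero - + g fzero) +ℤ ∑ℤ (λ l → + f (fsuc l) - + g (fsuc l))
    ≡⟨ cong ((+ f fzero - + g fzero) +ℤ_) (∑ℤ-difference (f ∘ fsuc) (g ∘ fsuc)) ⟩
  (+ f fzero - + g fzero) +ℤ (+ ∑ (f ∘ fsuc) - + ∑ (g ∘ fsuc))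
    ≡⟨ regroup (+ f fzero) (+ g fzero) (+ ∑ (f ∘ fsuc)) (+ ∑ (g ∘ fsuc)) ⟩
  (+ f fzero +ℤ + ∑ (f ∘ fsuc)) - (+ g fzero +ℤ + ∑ (g ∘ fsuc))
    ≡⟨ sym (cong₂ _-_ (pos-+ (f fzero) (∑ (f ∘ fsuc))) (pos-+ (g fzero) (∑ (g ∘ fsuc)))) ⟩
  + ∑ f - + ∑ g ∎
  where
  open ≡-Reasoning
  regroup : ∀ (a b c d : ℤ) → (a - b) +ℤ (c - d) ≡ (a +ℤ c) - (b +ℤ d)
  regroup = ℤ-Solver.solve-∀

m≤n+∣m-n∣ : ∀ m n → m ≤ n + ∣ + m - + n ∣
m≤n+∣m-n∣ m n rewrite [+m]-[+n]≡m⊖n m n with m ≤? n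
... | yes m≤n = ≤-trans m≤n (m≤m+n n _)
... | no  m≰n rewrite ⊖-≥ (<⇒≤ (≰⇒> m≰n)) = m≤n+m∸n m n

lookup-ext : ∀ {A : Set} {k} {u v : Vec A k} → (∀ i → lookup u i ≡ lookup v i) → u ≡ v
lookup-ext {u = u} {v} u≗v = trans (sym (tabulate∘lookup u)) (trans (tabulate-cong u≗v) (tabulate∘lookup v))

Mat-ext : ∀ {n c} {A B : Mat n c} → (∀ i j → entry A i j ≡ entry B i j) → A ≡ B
Mat-ext A≗B = lookup-ext (λ i → lookup-ext (A≗B i))

Mat-zero-columns : ∀ {n} (A B : Mat n 0) → A ≡ B
Mat-zero-columns A B = Mat-ext (λ i ())

entry-tabulate : ∀ {n c} (F : Fin n → Fin c → ℕ) i j → entry (tabulate (λ i → tabulate (F i))) i j ≡ F i j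
entry-tabulate F i j rewrite lookup∘tabulate (λ i → tabulate (F i)) i = lookup∘tabulate (F i) j

StrictlyUpper : ∀ {n} → Mat n n → Set
StrictlyUpper K = ∀ i j → toℕ j ≤ toℕ i → entry K i j ≡ 0

hookEntry : ∀ {n c} → Mat n n → Mat n c → Fin n → Fin n ⊎ Fin c → ℕ
hookEntry K C i (inj₁ j) = if toℕ i <ᵇ toℕ j then entry K i j else (if toℕ i ≡ᵇ toℕ j then toℕ i else 0)
hookEntry K C i (inj₂ t) = entry C i t

hookMatrix : ∀ {n c} → Mat n n → Mat n c → Mat n (n + c)
hookMatrix {n} K C = tabulate λ i → tabulate λ j → hookEntry K C i (splitAt n j)

strictPart : ∀ {n c} → Mat n (n + c) → Mat n n
strictPart {n} {c} A = tabulate λ i → tabulate λ j → if toℕ i <ᵇ toℕ j then entry A i (j ↑ˡ c) else 0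

lastColumns : ∀ {n c} → Mat n (n + c) → Mat n c
lastColumns {n} A = tabulate λ i → tabulate λ t → entry A i (n ↑ʳ t)

entry-hookMatrix : ∀ {n c} (K : Mat n n) (C : Mat n c) i j → entry (hookMatrix K C) i j ≡ hookEntry K C i (splitAt n j)
entry-hookMatrix {n} K C = entry-tabulate (λ i j → hookEntry K C i (splitAt n j))

entry-strictPart : ∀ {n c} (A : Mat n (n + c)) i j →
  entry (strictPart A) i j ≡ (if toℕ i <ᵇ toℕ j then entry A i (j ↑ˡ c) else 0)
entry-strictPart {c = c} A = entry-tabulate (λ i j → if toℕ i <ᵇ toℕ j then entry A i (j ↑ˡ c) else 0)

strictPart-strictlyUpper : ∀ {n c} (A : Mat n (n + c)) → StrictlyUpper (strictPart A)
strictPart-strictlyUpper A i j j≤i rewrite entry-strictPart A i j | ≥⇒<ᵇ≡false j≤i = refl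

strictPart-hookMatrix : ∀ {n c} (K : Mat n n) (C : Mat n c) → StrictlyUpper K →
  strictPart (hookMatrix K C) ≡ K
strictPart-hookMatrix {n} {c} K C K-upper = Mat-ext entry≡
  where
  entry≡ : ∀ i j → entry (strictPart (hookMatrix K C)) i j ≡ entry K i j
  entry≡ i j rewrite entry-strictPart (hookMatrix K C) i j with toℕ i <? toℕ j
  ... | yes i<j rewrite <⇒<ᵇ≡true i<j | entry-hookMatrix K C i (j ↑ˡ c) | splitAt-↑ˡ n j c
                      | <⇒<ᵇ≡true i<j = refl
  ... | no  i≮j rewrite ≥⇒<ᵇ≡false (≮⇒≥ i≮j) = sym (K-upper i j (≮⇒≥ i≮j))

lastColumns-hookMatrix : ∀ {n c} (K : Mat n n) (C : Mat n c) → lastColumns (hookMatrix K C) ≡ C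
lastColumns-hookMatrix {n} {c} K C = Mat-ext λ i t → begin
  entry (lastColumns (hookMatrix K C)) i t  ≡⟨ entry-tabulate (λ i t → entry (hookMatrix K C) i (n ↑ʳ t)) i t ⟩
  entry (hookMatrix K C) i (n ↑ʳ t)         ≡⟨ entry-hookMatrix K C i (n ↑ʳ t) ⟩
  hookEntry K C i (splitAt n (n ↑ʳ t))      ≡⟨ cong (hookEntry K C i) (splitAt-↑ʳ n c t) ⟩
  entry C i t                               ∎
  where open ≡-Reasoning

hookMatrix-IsU : ∀ {n c} (K : Mat n n) (C : Mat n c) → IsU {n} {c} (hookMatrix K C)
hookMatrix-IsU {n} {c} K C = lower , diagonal
  where
  lower : ∀ i j → toℕ j < toℕ i → entry (hookMatrix K C) i j ≡ 0
  lower i j j<i rewrite entry-hookMatrix K C i j with splitAt n j in eq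
  ... | inj₁ j′ rewrite sym (splitAt⁻¹-↑ˡ eq) | toℕ-↑ˡ j′ c
                      | ≥⇒<ᵇ≡false (<⇒≤ j<i)
                      | ≢⇒≡ᵇ≡false (λ i≡j′ → <-irrefl (sym i≡j′) j<i) = refl
  ... | inj₂ t  rewrite sym (splitAt⁻¹-↑ʳ eq) | toℕ-↑ʳ n t =
    ⊥-elim (<-irrefl refl (≤-trans j<i (≤-trans (<⇒≤ (toℕ<n i)) (m≤m+n n (toℕ t)))))
  diagonal : ∀ i → entry (hookMatrix K C) i (i ↑ˡ c) ≡ toℕ i
  diagonal i rewrite entry-hookMatrix K C i (i ↑ˡ c) | splitAt-↑ˡ n i c
                   | ≥⇒<ᵇ≡false (≤-refl {toℕ i}) | ≡ᵇ-refl (toℕ i) = refl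

hookMatrix-strictPart-lastColumns : ∀ {n c} (A : Mat n (n + c)) → IsU {n} {c} A →
  hookMatrix (strictPart A) (lastColumns A) ≡ A
hookMatrix-strictPart-lastColumns {n} {c} A (lower , diagonal) = Mat-ext entry≡
  where
  entry≡ : ∀ i j → entry (hookMatrix (strictPart A) (lastColumns A)) i j ≡ entry A i j
  entry≡ i j rewrite entry-hookMatrix (strictPart A) (lastColumns A) i j with splitAt n j in eq
  ... | inj₂ t rewrite entry-tabulate (λ i t → entry A i (n ↑ʳ t)) i t | splitAt⁻¹-↑ʳ eq = refl
  ... | inj₁ j′ rewrite entry-strictPart A i j′ | sym (splitAt⁻¹-↑ˡ eq) with <-cmp (toℕ i) (toℕ j′)
  ... | tri< i<j′ _ _ rewrite <⇒<ᵇ≡true i<j′ = refl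
  ... | tri≈ _ i≡j′ _ rewrite ≥⇒<ᵇ≡false (≤-reflexive (sym i≡j′)) | i≡j′ | ≡ᵇ-refl (toℕ j′)
                            | toℕ-injective i≡j′ = sym (diagonal j′)
  ... | tri> _ _ j′<i rewrite ≥⇒<ᵇ≡false (<⇒≤ j′<i)
                            | ≢⇒≡ᵇ≡false (λ i≡j′ → <-irrefl (sym i≡j′) j′<i) =
    sym (lower i (j′ ↑ˡ c) (subst (_< toℕ i) (sym (toℕ-↑ˡ j′ c)) j′<i))

positiveExponent : ∀ {n} → Mat n n → Fin n → ℕ
positiveExponent K i = ∑ (λ j → if toℕ i <ᵇ toℕ j then entry K i j else 0)

negativeExponent : ∀ {n} → Mat n n → Fin n → ℕ
negativeExponent K i = ∑ (λ j → if toℕ j <ᵇ toℕ i then suc (entry K j i) else 0)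

armSum-hookMatrix : ∀ {n c} (K : Mat n n) (C : Mat n c) i →
  ∑ (λ j → if toℕ i <ᵇ toℕ j then entry (hookMatrix K C) i j else 0) ≡ rowSum C i + positiveExponent K i
armSum-hookMatrix {n} {c} K C i = begin
  ∑ arm                                                     ≡⟨ ∑-↑ {n} {c} arm ⟩
  ∑ (λ j → arm (j ↑ˡ c)) + ∑ (λ t → arm (n ↑ʳ t))           ≡⟨ cong₂ _+_ (∑-cong inK) (∑-cong inC) ⟩
  positiveExponent K i + rowSum C i                         ≡⟨ +-comm (positiveExponent K i) (rowSum C i) ⟩
  rowSum C i + positiveExponent K i                         ∎
  where
  open ≡-Reasoning
  arm : Fin (n + c) → ℕ
  arm j = if toℕ i <ᵇ toℕ j then entry (hookMatrix K C) i j else 0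
  inK : ∀ j → arm (j ↑ˡ c) ≡ (if toℕ i <ᵇ toℕ j then entry K i j else 0)
  inK j rewrite toℕ-↑ˡ j c | entry-hookMatrix K C i (j ↑ˡ c) | splitAt-↑ˡ n j c with toℕ i <? toℕ j
  ... | yes i<j rewrite <⇒<ᵇ≡true i<j = refl
  ... | no  i≮j rewrite ≥⇒<ᵇ≡false (≮⇒≥ i≮j) = refl
  inC : ∀ t → arm (n ↑ʳ t) ≡ entry C i t
  inC t rewrite toℕ-↑ʳ n t | <⇒<ᵇ≡true (≤-trans (toℕ<n i) (m≤m+n n (toℕ t)))
              | entry-hookMatrix K C i (n ↑ʳ t) | splitAt-↑ʳ n c t = refl

-- The diagonal entry toℕ i of the leg supplies the i summands 1 of the negative exponent.
legSum-hookMatrix : ∀ {n c} (K : Mat n n) (C : Mat n c) i →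
  ∑ (λ j → if toℕ j ≤ᵇ toℕ i then entry (hookMatrix K C) j (i ↑ˡ c) else 0) ≡ negativeExponent K i
legSum-hookMatrix {n} {c} K C i = begin
  ∑ (λ j → if toℕ j ≤ᵇ toℕ i then entry (hookMatrix K C) j (i ↑ˡ c) else 0)  ≡⟨ ∑-cong leg≡ ⟩
  ∑ (λ j → above j + onDiagonal j)                    ≡⟨ ∑-distrib-+ above onDiagonal ⟩
  ∑ above + ∑ onDiagonal                              ≡⟨ cong (_+_ (∑ above)) (∑-[≡] i (toℕ i)) ⟩
  ∑ above + toℕ i                                     ≡⟨ cong (_+_ (∑ above)) (∑-[<]≡toℕ i) ⟨
  ∑ above + ∑ before                                  ≡⟨ ∑-distrib-+ above before ⟨
  ∑ (λ j → above j + before j)                        ≡⟨ ∑-cong suc≡ ⟩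
  negativeExponent K i                                ∎
  where
  open ≡-Reasoning
  above : Fin n → ℕ
  above j = if toℕ j <ᵇ toℕ i then entry K j i else 0
  before : Fin n → ℕ
  before j = if toℕ j <ᵇ toℕ i then 1 else 0
  onDiagonal : Fin n → ℕ
  onDiagonal j = if toℕ j ≡ᵇ toℕ i then toℕ i else 0
  leg≡ : ∀ j → (if toℕ j ≤ᵇ toℕ i then entry (hookMatrix K C) j (i ↑ˡ c) else 0)
              ≡ above j + onDiagonal j
  leg≡ j rewrite entry-hookMatrix K C j (i ↑ˡ c) | splitAt-↑ˡ n i c with <-cmp (toℕ j) (toℕ i)
  ... | tri< j<i _ _ rewrite ≤⇒≤ᵇ≡true (<⇒≤ j<i) | <⇒<ᵇ≡true j<i
                           | ≢⇒≡ᵇ≡false (λ j≡i → <-irrefl j≡i j<i) = sym (+-identityʳ _)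
  ... | tri≈ _ j≡i _ rewrite j≡i | ≤⇒≤ᵇ≡true (≤-refl {toℕ i}) | ≥⇒<ᵇ≡false (≤-refl {toℕ i})
                           | ≡ᵇ-refl (toℕ i) = refl
  ... | tri> _ _ i<j rewrite >⇒≤ᵇ≡false i<j | ≥⇒<ᵇ≡false (<⇒≤ i<j)
                           | ≢⇒≡ᵇ≡false (λ j≡i → <-irrefl (sym j≡i) i<j) = refl
  suc≡ : ∀ j → above j + before j ≡ (if toℕ j <ᵇ toℕ i then suc (entry K j i) else 0)
  suc≡ j with toℕ j <ᵇ toℕ i
  ... | true  = +-comm _ 1
  ... | false = refl

hookSum-hookMatrix : ∀ {n c} (K : Mat n n) (C : Mat n c) i →
  hookSum {n} {c} (hookMatrix K C) i ≡ + (rowSum C i + positiveExponent K i) - + negativeExponent K i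
hookSum-hookMatrix K C i =
  cong₂ (λ arm leg → + arm - + leg) (armSum-hookMatrix K C i) (legSum-hookMatrix K C i)

record PredBijection {X Y : Set} (P : X → Set) (Q : Y → Set) : Set where
  field
    to        : X → Y
    from      : Y → X
    to-resp   : ∀ x → P x → Q (to x)
    from-resp : ∀ y → Q y → P (from y)
    from∘to   : ∀ x → P x → from (to x) ≡ x
    to∘from   : ∀ y → Q y → to (from y) ≡ y

module _ {X Y : Set} {P : X → Set} {Q : Y → Set} (bij : PredBijection P Q) where
  open PredBijection bij

  private
    map-to-distinct : ∀ {x} xs → All (λ y → ¬ x ≡ y) xs → P x → All P xs →
      All (λ y → ¬ to x ≡ y) (map to xs)
    map-to-distinct []       []         _   []         = []
    map-to-distinct (y ∷ ys) (x≢y ∷ ds) P-x (P-y ∷ ps) =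
      (λ eq → x≢y (trans (sym (from∘to _ P-x)) (trans (cong from eq) (from∘to _ P-y))))
      ∷ map-to-distinct ys ds P-x ps

    map-to-unique : ∀ xs → Unique xs → All P xs → Unique (map to xs)
    map-to-unique []       []        []         = []
    map-to-unique (x ∷ xs) (d ∷ uniq) (P-x ∷ ps) = map-to-distinct xs d P-x ps ∷ map-to-unique xs uniq ps

  HasCount-transfer : ∀ {N} → HasCount P N → HasCount Q N
  HasCount-transfer (L , uniq , P⇔∈ , len≡N) =
    map to L , map-to-unique L uniq (All-tabulate (Equivalence.from (P⇔∈ _))) , Q⇔∈ , trans (length-map to L) len≡N
    where
    Q⇔∈ : ∀ y → Q y ⇔ (y ∈ map to L)
    Q⇔∈ y = mk⇔
      (λ Q-y → subst (_∈ map to L) (to∘from y Q-y)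
                 (∈-map⁺ to (Equivalence.to (P⇔∈ (from y)) (from-resp y Q-y))))
      (λ y∈ → let (x , x∈L , y≡) = ∈-map⁻ to y∈ in
                subst Q (sym y≡) (to-resp x (Equivalence.from (P⇔∈ x) x∈L)))

HasCount-enumeration : {X : Set} {P : X → Set} → DecidableEquality X → Decidable P →
  (L : List X) → (∀ x → P x → x ∈ L) → Σ ℕ (HasCount P)
HasCount-enumeration {P = P} _≟_ P? L covers =
  length L′ , L′ , deduplicate-! _≟_ (filter P? L) , P⇔∈ , refl
  where
  L′ : List _
  L′ = deduplicate _≟_ (filter P? L)
  P⇔∈ : ∀ x → P x ⇔ (x ∈ L′)
  P⇔∈ x = mk⇔ (λ P-x → ∈-deduplicate⁺ _≟_ (∈-filter⁺ P? (covers x P-x) P-x))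
              (λ x∈ → proj₂ (∈-filter⁻ P? {xs = L} (∈-deduplicate⁻ _≟_ (filter P? L) x∈)))

vecsOver : ∀ {A : Set} → List A → ∀ k → List (Vec A k)
vecsOver L zero    = [] ∷ []
vecsOver L (suc k) = cartesianProductWith _∷_ L (vecsOver L k)

∈-vecsOver : ∀ {A : Set} {L : List A} {k} (v : Vec A k) → (∀ i → lookup v i ∈ L) → v ∈ vecsOver L k
∈-vecsOver []      _  = here refl
∈-vecsOver (x ∷ v) v∈ = ∈-cartesianProductWith⁺ _∷_ (v∈ fzero) (∈-vecsOver v (v∈ ∘ fsuc))

boundedMats : ℕ → ∀ r c → List (Mat r c)
boundedMats M r c = vecsOver (vecsOver (upTo (suc M)) c) r

∈-boundedMats : ∀ {M r c} (A : Mat r c) → (∀ i j → entry A i j ≤ M) → A ∈ boundedMats M r c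
∈-boundedMats A A≤M = ∈-vecsOver A (λ i → ∈-vecsOver (lookup A i) (λ j → ∈-upTo⁺ (s≤s (A≤M i j))))

module LHSTermBound (n b m : ℕ) (e : Fin n → ℤ) where

  E : ℕ
  E = ∑ (λ i → ∣ e i ∣)

  -- rowBound r bounds the positive exponent at every row i < r: it exceeds the negative one by at
  -- most E, and the negative one involves only the entries of column i above row i.
  rowBound : ℕ → ℕ
  rowBound zero    = 0
  rowBound (suc r) = rowBound r + (E + m * (n * suc (rowBound r)))

  module _ (C : Mat n b) (K : Vec (Mat n n) m) (term : LHSTerm n b m e (C , K)) where

    positive : Fin n → ℕ
    positive i = rowSum C i + ∑ (λ l → positiveExponent (lookup K l) i)

    negative : Fin n → ℕ
    negative i = ∑ (λ l → negativeExponent (lookup K l) i)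

    lhsExp≡positive-negative : ∀ i → lhsExp {n} {b} {m} (C , K) i ≡ + positive i - + negative i
    lhsExp≡positive-negative i = begin
      + rowSum C i +ℤ ∑ℤ (λ l → + p l - + q l)    ≡⟨ cong (+ rowSum C i +ℤ_) (∑ℤ-difference p q) ⟩
      + rowSum C i +ℤ (+ ∑ p - + ∑ q)            ≡⟨ sym (+ℤ-assoc (+ rowSum C i) (+ ∑ p) (- + ∑ q)) ⟩
      (+ rowSum C i +ℤ + ∑ p) - + ∑ q            ≡⟨ cong (_- + ∑ q) (sym (pos-+ (rowSum C i) (∑ p))) ⟩
      + positive i - + negative i                ∎
      where
      open ≡-Reasoning
      p q : Fin m → ℕ
      p l = positiveExponent (lookup K l) i
      q l = negativeExponent (lookup K l) i

    positive≤negative+E : ∀ i → positive i ≤ negative i + E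
    positive≤negative+E i =
      ≤-trans (m≤n+∣m-n∣ (positive i) (negative i)) (+-mono-≤ (≤-refl {negative i}) ∣e-i∣≤E)
      where
      e-i≡ : e i ≡ + positive i - + negative i
      e-i≡ = trans (sym (proj₂ term i)) (lhsExp≡positive-negative i)
      ∣e-i∣≤E : ∣ + positive i - + negative i ∣ ≤ E
      ∣e-i∣≤E = subst (λ z → ∣ z ∣ ≤ E) e-i≡ (term≤∑ (λ i → ∣ e i ∣) i)

    negative≤ : ∀ i t → (∀ l j → toℕ j < toℕ i → entry (lookup K l) j i ≤ t) →
      negative i ≤ m * (n * suc t)
    negative≤ i t column≤t = subst (negative i ≤_) (∑-const {m} (n * suc t)) (∑-mono-≤ λ l →
      subst (negativeExponent (lookup K l) i ≤_) (∑-const {n} (suc t)) (∑-mono-≤ (summand≤ l)))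
      where
      summand≤ : ∀ l j → (if toℕ j <ᵇ toℕ i then suc (entry (lookup K l) j i) else 0) ≤ suc t
      summand≤ l j with toℕ j <? toℕ i
      ... | yes j<i rewrite <⇒<ᵇ≡true j<i = s≤s (column≤t l j j<i)
      ... | no  j≮i rewrite ≥⇒<ᵇ≡false (≮⇒≥ j≮i) = z≤n

    C≤positive : ∀ i t → entry C i t ≤ positive i
    C≤positive i t = ≤-trans (term≤∑ (entry C i) t) (m≤m+n _ _)

    K≤positive : ∀ l i j → toℕ i < toℕ j → entry (lookup K l) i j ≤ positive i
    K≤positive l i j i<j = ≤-trans (subst (_≤ positiveExponent (lookup K l) i) summand≡ (term≤∑ summand j))
                             (≤-trans (term≤∑ (λ l → positiveExponent (lookup K l) i) l) (m≤n+m _ _))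
      where
      summand : Fin n → ℕ
      summand j = if toℕ i <ᵇ toℕ j then entry (lookup K l) i j else 0
      summand≡ : summand j ≡ entry (lookup K l) i j
      summand≡ rewrite <⇒<ᵇ≡true i<j = refl

    positive≤rowBound : ∀ r i → toℕ i < r → positive i ≤ rowBound r
    positive≤rowBound (suc r) i (s≤s i≤r) =
      ≤-trans (positive≤negative+E i)
        (≤-trans (subst (_≤ E + m * (n * suc (rowBound r))) (+-comm E (negative i))
                   (+-mono-≤ (≤-refl {E}) (negative≤ i (rowBound r) column≤)))
          (m≤n+m _ (rowBound r)))
      where
      column≤ : ∀ l j → toℕ j < toℕ i → entry (lookup K l) j i ≤ rowBound r
      column≤ l j j<i = ≤-trans (K≤positive l j i j<i) (positive≤rowBound r j (≤-trans j<i i≤r))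

    C-bounded : ∀ i t → entry C i t ≤ rowBound n
    C-bounded i t = ≤-trans (C≤positive i t) (positive≤rowBound n i (toℕ<n i))

    K-bounded : ∀ l i j → entry (lookup K l) i j ≤ rowBound n
    K-bounded l i j with toℕ i <? toℕ j
    ... | yes i<j = ≤-trans (K≤positive l i j i<j) (positive≤rowBound n i (toℕ<n i))
    ... | no  i≮j rewrite proj₁ term l i j (≮⇒≥ i≮j) = z≤n

LHSTerm? : ∀ n b m e → Decidable (LHSTerm n b m e)
LHSTerm? n b m e (C , K) =
  all? (λ l → all? (λ i → all? (λ j → (toℕ j ≤? toℕ i) →-dec (entry (lookup K l) i j ≟ℕ 0))))
  ×-dec all? (λ i → lhsExp {n} {b} {m} (C , K) i ≟ℤ e i)

lhsCount : ∀ n b m e → Σ ℕ (HasCount (LHSTerm n b m e))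
lhsCount n b m e = HasCount-enumeration (×-≡-dec Mat-≟ (Vec-≡-dec Mat-≟)) (LHSTerm? n b m e)
  (cartesianProduct (boundedMats (rowBound n) n b) (vecsOver (boundedMats (rowBound n) n n) m)) covers
  where
  open LHSTermBound n b m e
  Mat-≟ : ∀ {r c} → DecidableEquality (Mat r c)
  Mat-≟ = Vec-≡-dec (Vec-≡-dec _≟ℕ_)
  covers : ∀ x → LHSTerm n b m e x → x ∈ _
  covers (C , K) term = ∈-cartesianProduct⁺ (∈-boundedMats C (C-bounded C K term))
                          (∈-vecsOver K (λ l → ∈-boundedMats (lookup K l) (K-bounded C K term l)))

lhs≅rhs : ∀ n b m e → PredBijection (LHSTerm n b m e) (RHSTerm n b m e)
lhs≅rhs n b m e = record
  { to = to ; from = from ; to-resp = to-resp ; from-resp = from-resp ; from∘to = from∘to ; to∘from = to∘from }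
  where
  square : Mat n n → Mat n (n + 0)
  square K = hookMatrix K (replicate n [])

  to : LHSIndex n b m → RHSIndex n b m
  to (C , K) = vmap square K , C

  from : RHSIndex n b m → LHSIndex n b m
  from (As , B) = B , vmap strictPart As

  rhsExp : RHSIndex n b m → Fin n → ℤ
  rhsExp (As , B) i = ∑ℤ (λ l → hookSum {n} {0} (lookup As l) i) +ℤ + rowSum B i

  hookSum-square : ∀ K l i → hookSum {n} {0} (lookup (vmap square K) l) i ≡
    + positiveExponent (lookup K l) i - + negativeExponent (lookup K l) i
  hookSum-square K l i = trans (cong (λ A → hookSum {n} {0} A i) (lookup-map l square K))
                               (hookSum-hookMatrix (lookup K l) (replicate n []) i)

  rhsExp-to : ∀ x i → rhsExp (to x) i ≡ lhsExp {n} {b} {m} x i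
  rhsExp-to (C , K) i = trans (cong (_+ℤ + rowSum C i) (∑ℤ-cong (λ l → hookSum-square K l i)))
    (+ℤ-comm (∑ℤ (λ l → + positiveExponent (lookup K l) i - + negativeExponent (lookup K l) i)) (+ rowSum C i))

  to-resp : ∀ x → LHSTerm n b m e x → RHSTerm n b m e (to x)
  to-resp (C , K) (_ , exp≡e) =
    (λ l → subst (IsU {n} {0}) (sym (lookup-map l square K)) (hookMatrix-IsU (lookup K l) (replicate n []))) ,
    (λ i → trans (rhsExp-to (C , K) i) (exp≡e i))

  to∘from : ∀ y → RHSTerm n b m e y → to (from y) ≡ y
  to∘from (As , B) (As-U , _) = cong (_, B) (lookup-ext λ l → begin
    lookup (vmap square (vmap strictPart As)) l   ≡⟨ lookup-map l square (vmap strictPart As) ⟩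
    square (lookup (vmap strictPart As) l)        ≡⟨ cong square (lookup-map l strictPart As) ⟩
    square (strictPart (lookup As l))
                                     ≡⟨ cong (hookMatrix _) (Mat-zero-columns _ (lastColumns (lookup As l))) ⟩
    hookMatrix (strictPart (lookup As l)) (lastColumns (lookup As l))
                                                  ≡⟨ hookMatrix-strictPart-lastColumns (lookup As l) (As-U l) ⟩
    lookup As l                                   ∎)
    where open ≡-Reasoning

  from∘to : ∀ x → LHSTerm n b m e x → from (to x) ≡ x
  from∘to (C , K) (K-upper , _) = cong (C ,_) (lookup-ext λ l →
    trans (lookup-map l strictPart (vmap square K))
      (trans (cong strictPart (lookup-map l square K)) (strictPart-hookMatrix (lookup K l) _ (K-upper l))))

  from-resp : ∀ y → RHSTerm n b m e y → LHSTerm n b m e (from y)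
  from-resp y@(As , B) y-term@(_ , exp≡e) =
    (λ l i j j≤i → trans (cong (λ K → entry K i j) (lookup-map l strictPart As))
                         (strictPart-strictlyUpper (lookup As l) i j j≤i)) ,
    (λ i → trans (sym (rhsExp-to (from y) i)) (trans (cong (λ y′ → rhsExp y′ i) (to∘from y y-term)) (exp≡e i)))

lhs≅rhs₁ : ∀ n b e → PredBijection (LHSTerm n b 1 e) (RHS1Term n b e)
lhs≅rhs₁ n b e = record
  { to = to ; from = from ; to-resp = to-resp ; from-resp = from-resp ; from∘to = from∘to ; to∘from = to∘from }
  where
  to : LHSIndex n b 1 → Mat n (n + b)
  to (C , K ∷ []) = hookMatrix K C

  from : Mat n (n + b) → LHSIndex n b 1
  from A = lastColumns A , strictPart A ∷ []

  hookSum-to : ∀ C K i → hookSum {n} {b} (hookMatrix K C) i ≡ lhsExp {n} {b} {1} (C , K ∷ []) i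
  hookSum-to C K i rewrite hookSum-hookMatrix K C i | pos-+ (rowSum C i) (positiveExponent K i) =
    regroup (+ rowSum C i) (+ positiveExponent K i) (+ negativeExponent K i)
    where
    regroup : ∀ (r p q : ℤ) → (r +ℤ p) - q ≡ r +ℤ ((p - q) +ℤ + 0)
    regroup = ℤ-Solver.solve-∀

  to-resp : ∀ x → LHSTerm n b 1 e x → RHS1Term n b e (to x)
  to-resp (C , K ∷ []) (_ , exp≡e) = hookMatrix-IsU K C , λ i → trans (hookSum-to C K i) (exp≡e i)

  to∘from : ∀ A → RHS1Term n b e A → to (from A) ≡ A
  to∘from A (A-U , _) = hookMatrix-strictPart-lastColumns A A-U

  from∘to : ∀ x → LHSTerm n b 1 e x → from (to x) ≡ x
  from∘to (C , K ∷ []) (K-upper , _) =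
    cong₂ (λ C′ K′ → C′ , K′ ∷ []) (lastColumns-hookMatrix K C) (strictPart-hookMatrix K C (K-upper fzero))

  from-resp : ∀ A → RHS1Term n b e A → LHSTerm n b 1 e (from A)
  from-resp A (A-U , hook≡e) =
    (λ { fzero → strictPart-strictlyUpper A }) ,
    (λ i → trans (sym (hookSum-to (lastColumns A) (strictPart A) i))
             (trans (cong (λ A′ → hookSum {n} {b} A′ i) (to∘from A (A-U , hook≡e))) (hook≡e i)))

commonCount : {X Y : Set} {P : X → Set} {Q : Y → Set} →
  Σ ℕ (HasCount P) → PredBijection P Q → Σ ℕ (λ N → HasCount P N × HasCount Q N)
commonCount (N , P-count) bij = N , P-count , HasCount-transfer bij P-count

lemma3p3 : (n b m : ℕ) → 1 ≤ n → (e : Fin n → ℤ) →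
    Σ ℕ (λ N → HasCount (LHSTerm n b m e) N × HasCount (RHSTerm n b m e) N)
    × Σ ℕ (λ N → HasCount (LHSTerm n b 1 e) N × HasCount (RHS1Term n b e) N)
lemma3p3 n b m _ e = commonCount (lhsCount n b m e) (lhs≅rhs n b m e) , commonCount (lhsCount n b 1 e) (lhs≅rhs₁ n b e)
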